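{- There exists a $(\mathbb Z_2^2\times\mathbb Z_4\times\mathbb Z_3^2,\{2^7,3^2\},3,1)$-difference family.
   Context: Let $(G,+)$ be a finite abelian group. A partial spread of $G$ is a family $\Sigma$ of subgroups of $G$ whose members pairwise intersect trivially; it has type $\{n_1^{f_1},\dots,n_t^{f_t}\}$ if it consists of exactly $f_i$ subgroups of order $n_i$ for each $i$ (and no others). For a triple $T=\{a,b,c\}$ of three distinct elements of $G$, $\Delta T$ is the multiset $\{\pm(a-b),\pm(a-c),\pm(b-c)\}$, and for a set $\mathcal T$ of triples, $\Delta\mathcal T$ is the multiset union of the $\Delta T$. For a partial spread $\Sigma$, a $(G,\Sigma,3,1)$-difference family is a set $\mathcal T$ of triples of $G$ with $\Delta\mathcal T=G\setminus\bigcup_{S\in\Sigma}S$ as multisets (each element outside the union occurs exactly once, elements of the union do not occur). A $(G,\tau,3,1)$-difference family is a $(G,\Sigma,3,1)$-difference family for some partial spread $\Sigma$ of $G$ of type $\tau$. -}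

module Defs where

open import Data.Nat using (ℕ; zero; suc; _+_; _∸_; _≡ᵇ_)
open import Data.Nat.DivMod using (_mod_)
open import Data.Fin using (Fin; toℕ)
open import Data.Bool using (Bool; true; false; not; if_then_else_)
open import Data.Product using (_×_; _,_; ∃-syntax; Σ-syntax)
open import Data.List using (List; []; _∷_; _++_; map; concatMap; allFin; cartesianProduct; filterᵇ; length)
open import Data.Nat.ListAction using (sum)
open import Data.Bool.ListAction using (any)
open import Data.List.Relation.Unary.AllPairs using (AllPairs)
open import Data.List.Relation.Unary.All using (All)
open import Data.List.Relation.Binary.Permutation.Propositional using (_↭_)
open import Relation.Binary.PropositionalEquality using (_≡_; _≢_)

_⊕_ : {n : ℕ} → Fin (suc n) → Fin (suc n) → Fin (suc n)
_⊕_ {n} a b = (toℕ a + toℕ b) mod (suc n)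

⊖_ : {n : ℕ} → Fin (suc n) → Fin (suc n)
⊖_ {n} a = (suc n ∸ toℕ a) mod (suc n)

z : {n : ℕ} → Fin (suc n)
z {n} = 0 mod (suc n)

G : Set
G = Fin 2 × Fin 2 × Fin 4 × Fin 3 × Fin 3

_+G_ : G → G → G
(a1 , a2 , a3 , a4 , a5) +G (b1 , b2 , b3 , b4 , b5) =
  (a1 ⊕ b1 , a2 ⊕ b2 , a3 ⊕ b3 , a4 ⊕ b4 , a5 ⊕ b5)

-G_ : G → G
-G (a1 , a2 , a3 , a4 , a5) = (⊖ a1 , ⊖ a2 , ⊖ a3 , ⊖ a4 , ⊖ a5)

0G : G
0G = (z , z , z , z , z)

_-G_ : G → G → G
a -G b = a +G (-G b)

allG : List G
allG = cartesianProduct (allFin 2) (cartesianProduct (allFin 2)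
         (cartesianProduct (allFin 4) (cartesianProduct (allFin 3) (allFin 3))))

record Subgroup : Set where
  field
    mem     : G → Bool
    has-0   : mem 0G ≡ true
    closed+ : ∀ a b → mem a ≡ true → mem b ≡ true → mem (a +G b) ≡ true
    closed- : ∀ a → mem a ≡ true → mem (-G a) ≡ true
open Subgroup public

order : Subgroup → ℕ
order S = length (filterᵇ (mem S) allG)

TrivialIntersection : Subgroup → Subgroup → Set
TrivialIntersection S S' = ∀ g → mem S g ≡ true → mem S' g ≡ true → g ≡ 0G

IsPartialSpread : List Subgroup → Set
IsPartialSpread Σ' = AllPairs TrivialIntersection Σ'

-- A type {n_1^{f_1},...,n_t^{f_t}} is given as a list of pairs (n_i , f_i)
-- with distinct n_i; multiplicity of order n in the type:
typeMult : List (ℕ × ℕ) → ℕ → ℕ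
typeMult [] n = 0
typeMult ((m , f) ∷ τ) n = (if m ≡ᵇ n then f else 0) + typeMult τ n

countOrder : ℕ → List Subgroup → ℕ
countOrder n Σ' = length (filterᵇ (λ S → order S ≡ᵇ n) Σ')

HasType : List Subgroup → List (ℕ × ℕ) → Set
HasType Σ' τ = (∀ n → countOrder n Σ' ≡ typeMult τ n) × (length Σ' ≡ sum (map (λ p → Data.Product.proj₂ p) τ))

Triple : Set
Triple = G × G × G

DistinctTriple : Triple → Set
DistinctTriple (a , b , c) = (a ≢ b) × (a ≢ c) × (b ≢ c)

ΔT : Triple → List G
ΔT (a , b , c) = (a -G b) ∷ (b -G a) ∷ (a -G c) ∷ (c -G a) ∷ (b -G c) ∷ (c -G b) ∷ []

Δ : List Triple → List G
Δ 𝒯 = concatMap ΔT 𝒯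

inUnion : List Subgroup → G → Bool
inUnion Σ' g = any (λ S → mem S g) Σ'

complementUnion : List Subgroup → List G
complementUnion Σ' = filterᵇ (λ g → not (inUnion Σ' g)) allG

-- (G, Σ, 3, 1)-difference family (multiset equality as permutation of lists)
IsDF : List Subgroup → List Triple → Set
IsDF Σ' 𝒯 = All DistinctTriple 𝒯 × (Δ 𝒯 ↭ complementUnion Σ')

HasDF : List (ℕ × ℕ) → Set
HasDF τ = ∃[ Σ' ] (IsPartialSpread Σ' × HasType Σ' τ × ∃[ 𝒯 ] IsDF Σ' 𝒯)

{-# OPTIONS --safe #-}
-- The spread consists of the seven subgroups of order 2, one for each involution of
-- Z₂² × Z₄, together with two of the four subgroups of order 3 of Z₃²; its union has
-- 1 + 7 + 4 = 12 elements. The remaining 132 = 22 · 6 elements are exactly the differences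
-- of 22 base blocks {0, x, y}. Every condition is then a finite decidable property,
-- established by running its decision procedure.
module Submission where

open import Defs
open import Data.Bool using (true)
open import Data.Fin using (#_)
open import Data.Fin.Properties using () renaming (_≟_ to _≟Fin_)
open import Data.List using (List; []; _∷_; _++_; map)
open import Data.List.Membership.Propositional using (_∈_)
open import Data.List.Membership.Propositional.Properties using (∈-∃++)
open import Data.List.Relation.Unary.Any using (here)
open import Data.List.Relation.Unary.All as All using (All; all?)
open import Data.List.Relation.Unary.AllPairs as AllPairs using (AllPairs; allPairs?)
open import Data.List.Relation.Unary.AllPairs.Properties using (map⁺)
open import Data.List.Relation.Binary.Permutation.Propositional using (_↭_; ↭-refl; ↭-sym; ↭-trans; prep)
open import Data.List.Relation.Binary.Permutation.Propositional.Properties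
  using (¬x∷xs↭[]; ∈-resp-↭; shift; drop-mid)
open import Data.Nat using (ℕ; suc)
open import Data.Product using (_×_; _,_)
open import Data.Product.Properties using (≡-dec)
open import Function using (_∘_; _on_)
open import Relation.Binary.Definitions using (DecidableEquality; Decidable)
open import Relation.Binary.PropositionalEquality using (_≡_; refl)
open import Relation.Nullary.Decidable
  using (Dec; yes; no; does; True; toWitness; from-yes; dec-true; ¬?; _×-dec_; _→-dec_)

from-does : ∀ {p} {P : Set p} (P? : Dec P) → does P? ≡ true → P
from-does (yes p) _ = p

module _ {a} {A : Set a} (_≟_ : DecidableEquality A) where
  open import Data.List.Membership.DecPropositional _≟_ using (_∈?_)

  ↭-dec : Decidable (_↭_ {A = A})
  ↭-dec []       []       = yes ↭-refl
  ↭-dec []       (y ∷ ys) = no (¬x∷xs↭[] ∘ ↭-sym)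
  ↭-dec (x ∷ xs) ys with x ∈? ys
  ... | no x∉ys = no (λ x∷xs↭ys → x∉ys (∈-resp-↭ x∷xs↭ys (here refl)))
  ... | yes x∈ys with ∈-∃++ x∈ys
  ...   | us , vs , refl with ↭-dec xs (us ++ vs)
  ...     | yes xs↭usvs = yes (↭-trans (prep x xs↭usvs) (↭-sym (shift x us vs)))
  ...     | no ¬xs↭usvs = no (¬xs↭usvs ∘ drop-mid [] us)

_≟G_ : DecidableEquality G
_≟G_ = ≡-dec _≟Fin_ (≡-dec _≟Fin_ (≡-dec _≟Fin_ (≡-dec _≟Fin_ _≟Fin_)))

open import Data.List.Membership.DecPropositional _≟G_ using (_∈?_)

IsSubgroupCarrier : List G → Set
IsSubgroupCarrier L = 0G ∈ L × All (λ x → All (λ y → x +G y ∈ L) L) L × All (λ x → -G x ∈ L) L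

isSubgroupCarrier? : (L : List G) → Dec (IsSubgroupCarrier L)
isSubgroupCarrier? L =
  0G ∈? L ×-dec all? (λ x → all? (λ y → x +G y ∈? L) L) L ×-dec all? (λ x → -G x ∈? L) L

subgroup : (L : List G) → IsSubgroupCarrier L → Subgroup
subgroup L (0∈L , +-closed , neg-closed) = record
  { mem     = λ g → does (g ∈? L)
  ; has-0   = dec-true (0G ∈? L) 0∈L
  ; closed+ = λ a b a∈L b∈L → dec-true (a +G b ∈? L)
      (All.lookup (All.lookup +-closed (from-does (a ∈? L) a∈L)) (from-does (b ∈? L) b∈L))
  ; closed- = λ a a∈L → dec-true (-G a ∈? L) (All.lookup neg-closed (from-does (a ∈? L) a∈L))
  }

record FiniteSubgroup : Set where
  constructor ⟨_⟩
  field
    elements     : List G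
    {isSubgroup} : True (isSubgroupCarrier? elements)

  toSubgroup : Subgroup
  toSubgroup = subgroup elements (toWitness isSubgroup)

open FiniteSubgroup

multiples : ℕ → G → List G
multiples 0       g = []
multiples (suc n) g = 0G ∷ map (g +G_) (multiples n g)

MeetTrivially : List G → List G → Set
MeetTrivially L L' = All (λ x → x ∈ L' → x ≡ 0G) L

meetTrivially? : Decidable (MeetTrivially on elements)
meetTrivially? S S' = all? (λ x → x ∈? elements S' →-dec x ≟G 0G) (elements S)

trivialIntersection : ∀ {S S'} → MeetTrivially (elements S) (elements S') →
                      TrivialIntersection (toSubgroup S) (toSubgroup S')
trivialIntersection meet g g∈S g∈S' = All.lookup meet (from-does (g ∈? _) g∈S) (from-does (g ∈? _) g∈S')

isPartialSpread : (𝒮 : List FiniteSubgroup) → AllPairs (MeetTrivially on elements) 𝒮 →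
                  IsPartialSpread (map toSubgroup 𝒮)
isPartialSpread 𝒮 = map⁺ ∘ AllPairs.map (λ {S} {S'} → trivialIntersection {S} {S'})

distinctTriple? : (T : Triple) → Dec (DistinctTriple T)
distinctTriple? (a , b , c) = ¬? (a ≟G b) ×-dec ¬? (a ≟G c) ×-dec ¬? (b ≟G c)

𝒮₀ : List FiniteSubgroup
𝒮₀ = ⟨ multiples 2 (# 0 , # 0 , # 2 , # 0 , # 0) ⟩
   ∷ ⟨ multiples 2 (# 0 , # 1 , # 0 , # 0 , # 0) ⟩
   ∷ ⟨ multiples 2 (# 0 , # 1 , # 2 , # 0 , # 0) ⟩
   ∷ ⟨ multiples 2 (# 1 , # 0 , # 0 , # 0 , # 0) ⟩
   ∷ ⟨ multiples 2 (# 1 , # 0 , # 2 , # 0 , # 0) ⟩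
   ∷ ⟨ multiples 2 (# 1 , # 1 , # 0 , # 0 , # 0) ⟩
   ∷ ⟨ multiples 2 (# 1 , # 1 , # 2 , # 0 , # 0) ⟩
   ∷ ⟨ multiples 3 (# 0 , # 0 , # 0 , # 1 , # 0) ⟩
   ∷ ⟨ multiples 3 (# 0 , # 0 , # 0 , # 0 , # 1) ⟩
   ∷ []

Σ₀ : List Subgroup
Σ₀ = map toSubgroup 𝒮₀

𝒯₀ : List Triple
𝒯₀ = map (0G ,_)
  ( ((# 0 , # 0 , # 2 , # 1 , # 1) , (# 0 , # 1 , # 0 , # 1 , # 2))
  ∷ ((# 0 , # 0 , # 2 , # 1 , # 2) , (# 0 , # 1 , # 1 , # 2 , # 0))
  ∷ ((# 0 , # 0 , # 1 , # 1 , # 2) , (# 0 , # 1 , # 2 , # 1 , # 0))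
  ∷ ((# 0 , # 1 , # 1 , # 1 , # 2) , (# 1 , # 0 , # 2 , # 1 , # 1))
  ∷ ((# 0 , # 0 , # 2 , # 0 , # 1) , (# 1 , # 1 , # 2 , # 1 , # 0))
  ∷ ((# 0 , # 1 , # 0 , # 1 , # 1) , (# 1 , # 0 , # 2 , # 1 , # 2))
  ∷ ((# 0 , # 0 , # 1 , # 0 , # 0) , (# 0 , # 1 , # 2 , # 1 , # 1))
  ∷ ((# 0 , # 1 , # 1 , # 1 , # 0) , (# 1 , # 1 , # 2 , # 1 , # 2))
  ∷ ((# 0 , # 0 , # 2 , # 1 , # 0) , (# 1 , # 0 , # 1 , # 0 , # 1))
  ∷ ((# 0 , # 1 , # 2 , # 1 , # 2) , (# 1 , # 1 , # 0 , # 1 , # 0))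
  ∷ ((# 0 , # 0 , # 1 , # 2 , # 2) , (# 1 , # 0 , # 2 , # 1 , # 0))
  ∷ ((# 0 , # 1 , # 0 , # 0 , # 1) , (# 1 , # 1 , # 1 , # 1 , # 1))
  ∷ ((# 0 , # 0 , # 1 , # 2 , # 1) , (# 1 , # 1 , # 2 , # 1 , # 1))
  ∷ ((# 0 , # 0 , # 0 , # 1 , # 1) , (# 0 , # 1 , # 1 , # 0 , # 2))
  ∷ ((# 0 , # 1 , # 1 , # 0 , # 0) , (# 1 , # 0 , # 0 , # 1 , # 1))
  ∷ ((# 0 , # 0 , # 1 , # 2 , # 0) , (# 1 , # 1 , # 1 , # 0 , # 1))
  ∷ ((# 0 , # 0 , # 1 , # 1 , # 1) , (# 1 , # 1 , # 0 , # 0 , # 1))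
  ∷ ((# 0 , # 1 , # 0 , # 1 , # 0) , (# 1 , # 1 , # 1 , # 0 , # 0))
  ∷ ((# 0 , # 0 , # 0 , # 1 , # 2) , (# 1 , # 1 , # 1 , # 2 , # 1))
  ∷ ((# 0 , # 0 , # 1 , # 0 , # 1) , (# 1 , # 0 , # 1 , # 1 , # 1))
  ∷ ((# 0 , # 0 , # 1 , # 0 , # 2) , (# 1 , # 0 , # 1 , # 0 , # 0))
  ∷ ((# 0 , # 0 , # 1 , # 1 , # 0) , (# 1 , # 0 , # 1 , # 2 , # 2))
  ∷ [])

τ₀ : List (ℕ × ℕ)
τ₀ = (2 , 7) ∷ (3 , 2) ∷ []

hasType : HasType Σ₀ τ₀
hasType = countsMatch , refl
  where
  -- Members have orders 2 and 3, so `order S ≡ᵇ n` reduces once n is unfolded past 3.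
  countsMatch : ∀ n → countOrder n Σ₀ ≡ typeMult τ₀ n
  countsMatch 0                         = refl
  countsMatch 1                         = refl
  countsMatch 2                         = refl
  countsMatch 3                         = refl
  countsMatch (suc (suc (suc (suc _)))) = refl

lemma3p13 : HasDF ((2 , 7) ∷ (3 , 2) ∷ [])
lemma3p13 =
  Σ₀ , isPartialSpread 𝒮₀ (from-yes (allPairs? meetTrivially? 𝒮₀)) , hasType ,
  𝒯₀ , from-yes (all? distinctTriple? 𝒯₀) , from-yes (↭-dec _≟G_ (Δ 𝒯₀) (complementUnion Σ₀))
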